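{- Let $\mathcal{C}$ be a class of finite hypergraphs such that for every $H\in\mathcal{C}$ and every integer $m\geq 1$, the disjoint union of $m$ copies of $H$ also belongs to $\mathcal{C}$. Suppose there exist a constant $c>0$ and a function $f:\mathbb{N}\to\mathbb{R}$ with $f(n)\to 0$ as $n\to\infty$ such that every $H\in\mathcal{C}$ on $n$ vertices satisfies $\tau_g(H)\leq (c+f(n))n$. Then every $H\in\mathcal{C}$ on $n$ vertices satisfies $\tau_g(H)\leq cn+1$.
   Context: For a finite hypergraph $H$, the transversal game is played by two players, Edge-hitter and Staller, who alternately select vertices of $H$, with the rule that each newly selected vertex must be contained in at least one edge of $H$ that does not intersect the set of previously selected vertices. The game ends when the set of selected vertices is a transversal of $H$, i.e., intersects every edge of $H$. Edge-hitter wants to end the game in as few moves as possible, Staller wants it to last as long as possible. The game transversal number $\tau_g(H)$ is the number of moves played when Edge-hitter starts and both players play optimally.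
   Formalization: The constant $c$ and the values of the function $f$ are rational rather than real. -}

module Defs where

open import Data.Nat using (ℕ; zero; suc; _*_; _⊓_; _⊔_)
open import Data.Bool using (Bool; true; false; _∧_; _∨_; not; if_then_else_; T?)
open import Data.Fin using (Fin; remQuot; _≟_)
open import Data.Fin.Subset using (Subset; Nonempty)
open import Data.Vec using (lookup; tabulate; _[_]≔_; replicate)
open import Data.List using (List; []; _∷_; map; filter; foldr; allFin; concatMap)
open import Data.Bool.ListAction using (any; all)
open import Data.List.Relation.Unary.All using (All)
open import Data.Product using (_,_)
open import Relation.Nullary.Decidable using (⌊_⌋)
open import Relation.Binary.PropositionalEquality using (_≡_)

record Hypergraph : Set where
  constructor hypergraph
  field
    order : ℕ
    edges : List (Subset order)
open Hypergraph public

NoEmptyEdge : Hypergraph → Set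
NoEmptyEdge H = All Nonempty (edges H)

module _ {n : ℕ} where
  meets : Subset n → Subset n → Bool
  meets e S = any (λ i → lookup e i ∧ lookup S i) (allFin n)

  isTransversal : List (Subset n) → Subset n → Bool
  isTransversal es S = all (λ e → meets e S) es

  legal : List (Subset n) → Subset n → Fin n → Bool
  legal es S v = any (λ e → lookup e v ∧ not (meets e S)) es

minList : List ℕ → ℕ
minList [] = 0
minList (x ∷ xs) = foldr _⊓_ x xs

maxList : List ℕ → ℕ
maxList [] = 0
maxList (x ∷ xs) = foldr _⊔_ x xs

-- Number of remaining moves under optimal play, from position S,
-- with player to move (true = Edge-hitter, false = Staller).
-- The fuel k bounds the depth; since each move selects a new vertex,
-- fuel n (number of vertices) is never exhausted before the game ends.
gameValue : {n : ℕ} → List (Subset n) → ℕ → Bool → Subset n → ℕ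
gameValue es zero p S = 0
gameValue {n} es (suc k) p S =
  if isTransversal es S then 0
  else suc (opt (map (λ v → gameValue es k (not p) (S [ v ]≔ true))
                     (filter (λ v → T? (legal es S v)) (allFin n))))
  where
  opt : List ℕ → ℕ
  opt = if p then minList else maxList

τg : Hypergraph → ℕ
τg H = gameValue (edges H) (order H) true (replicate (order H) false)

-- disjoint union of m copies of H: copy j uses vertices combine j i
-- (i.e. j * order H + i) for i : Fin (order H)
liftEdge : {m n : ℕ} → Fin m → Subset n → Subset (m * n)
liftEdge {m} {n} j e = tabulate λ x → f (remQuot n x)
  where
  f : _ → Bool
  f (a , b) = ⌊ a ≟ j ⌋ ∧ lookup e b

copies : ℕ → Hypergraph → Hypergraph
copies m H = hypergraph (m * order H)
  (concatMap (λ j → map (liftEdge j) (edges H)) (allFin m))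

-- Staller can make the disjoint union of m copies of H last at least m (τg H − 1) moves. Let the
-- potential of a position be the sum, over the copies, of (the value of the game on that copy with
-- Edge-hitter to move) − 1; it is m (τg H − 1) at the start. When Edge-hitter plays in a copy, Staller
-- answers optimally in the same copy; if Edge-hitter has just finished that copy, she plays in any
-- unfinished copy instead, as if it were her turn there. Each such round of two moves lowers the
-- potential by at most two, the out-of-turn case because an extra selected vertex never lengthens a
-- game. Hence m (τg H − 1) ≤ τg (mH) ≤ (c + f(mn)) mn for every m ≥ 1; dividing by m and letting
-- m → ∞ gives τg H − 1 ≤ cn.

{-# OPTIONS --safe #-}
module Submission where

open import Defs
open import Data.Nat using (ℕ; _≤_)
open import Data.Integer using (+_)
open import Data.Rational as ℚ using (ℚ; 0ℚ; 1ℚ; ∣_∣)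
open import Data.Product using (∃-syntax)

open import Algebra.Bundles using (CommutativeRing)
open import Data.Bool using (Bool; true; false; not; _∧_; T; T?)
open import Data.Bool.Properties using (T-∧)
open import Data.Empty using (⊥-elim)
open import Data.Fin using (Fin; zero; suc; _≟_; combine; remQuot)
open import Data.Fin.Properties
  using (combine-injectiveˡ; combine-injectiveʳ; remQuot-combine; combine-remQuot; punchInᵢ≢i)
open import Data.Fin.Subset using (Subset; Nonempty)
open import Data.Integer using (-[1+_])
import Data.Integer as ℤ
import Data.Integer.Properties as ℤP
open import Data.List using (List; []; _∷_; map; filter; allFin)
open import Data.List.Membership.Propositional using (_∈_; find; lose)
open import Data.List.Membership.Propositional.Properties
  using (∈-map⁺; ∈-map⁻; ∈-filter⁺; ∈-filter⁻; ∈-allFin; ∈-concatMap⁺; ∈-concatMap⁻)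
open import Data.List.Properties using (foldr-preservesᵇ; foldr-preservesᵒ)
open import Data.List.Relation.Unary.All as All using (All)
open import Data.List.Relation.Unary.All.Properties using (all⁺; all⁻; ¬All⇒Any¬)
open import Data.List.Relation.Unary.Any as Any using (Any; here; there)
open import Data.List.Relation.Unary.Any.Properties using (any⁺; any⁻)
open import Data.Nat using (zero; suc; _+_; _∸_; _*_; _⊓_; _⊔_; _<_; z≤n; s≤s; s≤s⁻¹)
open import Data.Nat.Coprimality using (1-coprimeTo) renaming (sym to coprime-sym)
open import Data.Nat.Properties
  using (≤-refl; ≤-reflexive; ≤-trans; m≤n⇒m⊓o≤n; m≤n⇒o⊓m≤n; m≤n⇒m≤n⊔o; m≤n⇒m≤o⊔n;
         ⊓-glb; ⊔-lub; ⊔-sel; suc-injective; n≤1+n; m≤m*n; +-mono-≤; +-assoc; +-0-commutativeMonoid;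
         ∸-monoˡ-≤; m≤n+m∸n; *-zeroʳ; n≤0⇒n≡0; module ≤-Reasoning)
open import Data.Product as Product using (_,_; _×_; ∃; ∃₂; proj₁; proj₂; uncurry)
open import Data.Rational using (mkℚ; *≤*)
import Data.Rational.Properties as ℚP
open import Data.Sum as Sum using (_⊎_; inj₁; inj₂; [_,_]′)
open import Data.Vec using ([]; _∷_; lookup; replicate; tabulate; _[_]≔_)
open import Data.Vec.Functional using (Vector; removeAt)
open import Data.Vec.Properties
  using ([]=⇒lookup; lookup⇒[]=; lookup∘update; lookup∘update′; lookup∘tabulate; tabulate-cong; lookup-replicate)
open import Data.Vec.Relation.Binary.Pointwise.Extensional using (ext; Pointwise-≡⇒≡)
open import Function using (_∘_)
open import Function.Bundles using (Equivalence)
open import Relation.Binary.PropositionalEquality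
  using (_≡_; _≢_; refl; sym; trans; cong; cong₂; subst; subst₂; module ≡-Reasoning)
open import Relation.Nullary using (¬_; contradiction; yes; no)
open import Relation.Nullary.Decidable using (⌊_⌋)

open import Algebra.Properties.AbelianGroup ℚP.+-0-abelianGroup using (xyx⁻¹≈y)
open import Algebra.Properties.CommutativeMonoid.Sum +-0-commutativeMonoid using (sum; sum-remove; sum-cong-≗)
open import Algebra.Properties.CommutativeSemigroup (CommutativeRing.*-commutativeSemigroup ℚP.+-*-commutativeRing)
  using (x∙yz≈y∙xz)

minList-≤ : ∀ {x xs} → x ∈ xs → minList xs ≤ x
minList-≤ {x} {y ∷ ys} x∈ = foldr-preservesᵒ {P = _≤ x} pres y ys (lift x∈)
  where
  pres : ∀ a b → a ≤ x ⊎ b ≤ x → a ⊓ b ≤ x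
  pres a b = [ m≤n⇒m⊓o≤n b , m≤n⇒o⊓m≤n a ]′
  lift : x ∈ y ∷ ys → y ≤ x ⊎ Any (_≤ x) ys
  lift (here refl) = inj₁ ≤-refl
  lift (there x∈ys) = inj₂ (Any.map (λ { refl → ≤-refl }) x∈ys)

≤-minList : ∀ {b x xs} → x ∈ xs → (∀ {y} → y ∈ xs → b ≤ y) → b ≤ minList xs
≤-minList {b} {xs = y ∷ ys} _ b≤ =
  foldr-preservesᵇ {P = b ≤_} ⊓-glb (b≤ (here refl)) (All.tabulate (b≤ ∘ there))

≤-maxList : ∀ {x xs} → x ∈ xs → x ≤ maxList xs
≤-maxList {x} {y ∷ ys} x∈ = foldr-preservesᵒ {P = x ≤_} pres y ys (lift x∈)
  where
  pres : ∀ a b → x ≤ a ⊎ x ≤ b → x ≤ a ⊔ b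
  pres a b = [ m≤n⇒m≤n⊔o b , m≤n⇒m≤o⊔n a ]′
  lift : x ∈ y ∷ ys → x ≤ y ⊎ Any (x ≤_) ys
  lift (here refl) = inj₁ ≤-refl
  lift (there x∈ys) = inj₂ (Any.map (λ { refl → ≤-refl }) x∈ys)

maxList-≤ : ∀ {b xs} → (∀ {y} → y ∈ xs → y ≤ b) → maxList xs ≤ b
maxList-≤ {xs = []} _ = z≤n
maxList-≤ {b} {y ∷ ys} ≤b = foldr-preservesᵇ {P = _≤ b} ⊔-lub (≤b (here refl)) (All.tabulate (≤b ∘ there))

maxList-∈ : ∀ {x xs} → x ∈ xs → maxList xs ∈ xs
maxList-∈ {xs = y ∷ ys} _ =
  foldr-preservesᵇ {P = _∈ y ∷ ys} pres (here refl) (All.tabulate there)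
  where
  pres : ∀ {a b} → a ∈ y ∷ ys → b ∈ y ∷ ys → a ⊔ b ∈ y ∷ ys
  pres {a} {b} a∈ b∈ with ⊔-sel a b
  ... | inj₁ a⊔b≡a = subst (_∈ y ∷ ys) (sym a⊔b≡a) a∈
  ... | inj₂ a⊔b≡b = subst (_∈ y ∷ ys) (sym a⊔b≡b) b∈

sum-mono : ∀ {k} {f g : Vector ℕ k} → (∀ i → f i ≤ g i) → sum f ≤ sum g
sum-mono {zero} _ = z≤n
sum-mono {suc k} f≤g = +-mono-≤ (f≤g zero) (sum-mono (f≤g ∘ suc))

sum-≤-except : ∀ {k} {f g : Vector ℕ k} j d → (∀ i → i ≢ j → f i ≤ g i) → f j ≤ d + g j →
               sum f ≤ d + sum g
sum-≤-except {suc k} {f} {g} j d f≤g fj≤ = begin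
  sum f                          ≡⟨ sum-remove {i = j} f ⟩
  f j + sum (removeAt f j)       ≤⟨ +-mono-≤ fj≤ (sum-mono (λ i → f≤g _ (punchInᵢ≢i j i))) ⟩
  d + g j + sum (removeAt g j)   ≡⟨ +-assoc d (g j) _ ⟩
  d + (g j + sum (removeAt g j)) ≡⟨ cong (λ t → d + t) (sum-remove {i = j} g) ⟨
  d + sum g                      ∎
  where open ≤-Reasoning

sum-const : ∀ k a → sum {k} (λ _ → a) ≡ k * a
sum-const zero a = refl
sum-const (suc k) a = cong (λ t → a + t) (sum-const k a)

T-not⁺ : ∀ {x} → ¬ T x → T (not x)
T-not⁺ {false} _ = _
T-not⁺ {true} ¬t = ¬t _

T-not⁻ : ∀ {x} → T (not x) → ¬ T x
T-not⁻ {false} _ ()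

module _ {n : ℕ} where

  meets⁺ : ∀ (e S : Subset n) i → T (lookup e i) → T (lookup S i) → T (meets e S)
  meets⁺ e S i ei Si = any⁺ _ (lose (∈-allFin i) (Equivalence.from T-∧ (ei , Si)))

  meets⁻ : ∀ (e S : Subset n) → T (meets e S) → ∃ λ i → T (lookup e i) × T (lookup S i)
  meets⁻ e S h = let i , t = Any.satisfied (any⁻ _ (allFin n) h) in i , Equivalence.to T-∧ t

  meets-select⁺ : ∀ (e S : Subset n) v → T (meets e S) ⊎ T (lookup e v) → T (meets e (S [ v ]≔ true))
  meets-select⁺ e S v (inj₁ m) = let i , ei , Si = meets⁻ e S m in meets⁺ e (S [ v ]≔ true) i ei (select-keeps i Si)
    where
    select-keeps : ∀ i → T (lookup S i) → T (lookup (S [ v ]≔ true) i)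
    select-keeps i Si with i ≟ v
    ... | yes refl = subst T (sym (lookup∘update v S true)) _
    ... | no i≢v = subst T (sym (lookup∘update′ i≢v S true)) Si
  meets-select⁺ e S v (inj₂ ev) = meets⁺ e (S [ v ]≔ true) v ev (subst T (sym (lookup∘update v S true)) _)

  meets-select⁻ : ∀ (e S : Subset n) v → T (meets e (S [ v ]≔ true)) → T (meets e S) ⊎ T (lookup e v)
  meets-select⁻ e S v m with meets⁻ e (S [ v ]≔ true) m
  ... | i , ei , S'i with i ≟ v
  ...   | yes refl = inj₂ ei
  ...   | no i≢v = inj₁ (meets⁺ e S i ei (subst T (lookup∘update′ i≢v S true) S'i))

unselected : ∀ {n} → Subset n → ℕ
unselected [] = 0
unselected (true ∷ S) = unselected S
unselected (false ∷ S) = suc (unselected S)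

unselected-select : ∀ {n} (S : Subset n) v → lookup S v ≡ false → unselected S ≡ suc (unselected (S [ v ]≔ true))
unselected-select (false ∷ S) zero refl = refl
unselected-select (true ∷ S) (suc v) Sv = unselected-select S v Sv
unselected-select (false ∷ S) (suc v) Sv = cong suc (unselected-select S v Sv)

unselected-replicate : ∀ n → unselected (replicate n false) ≡ n
unselected-replicate zero = refl
unselected-replicate (suc n) = cong suc (unselected-replicate n)

module Game {n : ℕ} (es : List (Subset n)) where

  moves : Subset n → List (Fin n)
  moves S = filter (λ v → T? (legal es S v)) (allFin n)

  successors : ℕ → Bool → Subset n → List ℕ
  successors k p S = map (λ v → gameValue es k p (S [ v ]≔ true)) (moves S)

  module _ (S : Subset n) where

    legal⁺ : ∀ {e v} → e ∈ es → T (lookup e v) → ¬ T (meets e S) → T (legal es S v)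
    legal⁺ e∈ ev ¬m = any⁺ _ (lose e∈ (Equivalence.from T-∧ (ev , T-not⁺ ¬m)))

    legal⁻ : ∀ {v} → T (legal es S v) → ∃ λ e → e ∈ es × T (lookup e v) × ¬ T (meets e S)
    legal⁻ h = let e , e∈ , t = find (any⁻ _ es h) ; ev , ¬m = Equivalence.to T-∧ t
               in e , e∈ , ev , T-not⁻ ¬m

    isTransversal⁺ : (∀ {e} → e ∈ es → T (meets e S)) → T (isTransversal es S)
    isTransversal⁺ h = all⁻ _ (All.tabulate h)

    isTransversal⁻ : T (isTransversal es S) → ∀ {e} → e ∈ es → T (meets e S)
    isTransversal⁻ h = All.lookup (all⁺ _ es h)

    legal⇒¬isTransversal : ∀ {v} → T (legal es S v) → ¬ T (isTransversal es S)
    legal⇒¬isTransversal lv t = let _ , e∈ , _ , ¬m = legal⁻ lv in ¬m (isTransversal⁻ t e∈)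

    legal⇒unselected : ∀ {v} → T (legal es S v) → lookup S v ≡ false
    legal⇒unselected {v} lv with legal⁻ lv | lookup S v in eq
    ... | _ | false = refl
    ... | e , _ , ev , ¬m | true = ⊥-elim (¬m (meets⁺ e S v ev (subst T (sym eq) _)))

    legal-exists : All Nonempty es → ¬ T (isTransversal es S) → ∃ λ v → T (legal es S v)
    legal-exists ne ¬t =
      let e , e∈ , ¬m = find (¬All⇒Any¬ (λ e → T? (meets e S)) es (¬t ∘ all⁻ _))
          v , v∈e = All.lookup ne e∈
      in v , legal⁺ e∈ (subst T (sym ([]=⇒lookup v∈e)) _) ¬m

  ∈-successors⁺ : ∀ k p S {v} → T (legal es S v) → gameValue es k p (S [ v ]≔ true) ∈ successors k p S
  ∈-successors⁺ k p S lv = ∈-map⁺ _ (∈-filter⁺ (λ v → T? (legal es S v)) (∈-allFin _) lv)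

  ∈-successors⁻ : ∀ k p S {x} → x ∈ successors k p S →
                  ∃ λ v → T (legal es S v) × x ≡ gameValue es k p (S [ v ]≔ true)
  ∈-successors⁻ k p S x∈ = let v , v∈ , eq = ∈-map⁻ _ x∈ in
    v , proj₂ (∈-filter⁻ (λ v → T? (legal es S v)) {xs = allFin n} v∈) , eq

  gameValue-transversal : ∀ k p S → T (isTransversal es S) → gameValue es k p S ≡ 0
  gameValue-transversal zero p S t = refl
  gameValue-transversal (suc k) p S t with isTransversal es S
  ... | true = refl

  gameValue-hitter : ∀ S k → ¬ T (isTransversal es S) →
                     gameValue es (suc k) true S ≡ suc (minList (successors k false S))
  gameValue-hitter S k ¬t with isTransversal es S
  ... | false = refl
  ... | true = ⊥-elim (¬t _)

  gameValue-staller : ∀ S k → ¬ T (isTransversal es S) →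
                      gameValue es (suc k) false S ≡ suc (maxList (successors k true S))
  gameValue-staller S k ¬t with isTransversal es S
  ... | false = refl
  ... | true = ⊥-elim (¬t _)

  record _≼_ (S U : Subset n) : Set where
    constructor hits-more
    field meets-mono : ∀ {e} → e ∈ es → T (meets e S) → T (meets e U)
  open _≼_

  ≼-select : ∀ S v → S ≼ (S [ v ]≔ true)
  ≼-select S v = hits-more λ {e} _ m → meets-select⁺ e S v (inj₁ m)

  ≼-select-both : ∀ {S U} v → S ≼ U → (S [ v ]≔ true) ≼ (U [ v ]≔ true)
  ≼-select-both {S} {U} v S≼U =
    hits-more λ {e} e∈ m → meets-select⁺ e U v (Sum.map₁ (meets-mono S≼U e∈) (meets-select⁻ e S v m))

  ≼-select-illegal : ∀ {S U u} w → S ≼ U → ¬ T (legal es U u) → (S [ u ]≔ true) ≼ (U [ w ]≔ true)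
  ≼-select-illegal {S} {U} {u} w S≼U ¬lu = hits-more λ {e} e∈ m → meets-select⁺ e U w (inj₁ (meets-U e∈ m))
    where
    meets-U : ∀ {e} → e ∈ es → T (meets e (S [ u ]≔ true)) → T (meets e U)
    meets-U {e} e∈ m with meets-select⁻ e S u m | T? (meets e U)
    ... | inj₁ mS | _ = meets-mono S≼U e∈ mS
    ... | inj₂ _ | yes mU = mU
    ... | inj₂ eu | no ¬mU = ⊥-elim (¬lu (legal⁺ U e∈ eu ¬mU))

  ≼-isTransversal : ∀ {S U} → S ≼ U → T (isTransversal es S) → T (isTransversal es U)
  ≼-isTransversal {S} {U} S≼U t = isTransversal⁺ U (λ e∈ → meets-mono S≼U e∈ (isTransversal⁻ S t e∈))

  ≼-legal : ∀ {S U v} → S ≼ U → T (legal es U v) → T (legal es S v)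
  ≼-legal {S} {U} S≼U lv = let _ , e∈ , ev , ¬m = legal⁻ U lv in legal⁺ S e∈ ev (¬m ∘ meets-mono S≼U e∈)

  gameValue-mono : All Nonempty es → ∀ {k k′ p S U} → k ≤ k′ → S ≼ U →
                   gameValue es k p U ≤ gameValue es k′ p S
  gameValue-mono ne z≤n _ = z≤n
  gameValue-mono ne {suc k} {suc k′} {p} {S} {U} (s≤s k≤k′) S≼U
    with T? (isTransversal es U) | T? (isTransversal es S)
  ... | yes tU | _ = ≤-trans (≤-reflexive (gameValue-transversal (suc k) p U tU)) z≤n
  ... | no ¬tU | yes tS = contradiction (≼-isTransversal S≼U tS) ¬tU
  ... | no ¬tU | no ¬tS = by-turn p
    where
    IH : ∀ {p S′ U′} → S′ ≼ U′ → gameValue es k p U′ ≤ gameValue es k′ p S′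
    IH = gameValue-mono ne k≤k′

    hitter-bound : ∀ {y} → y ∈ successors k′ false S → minList (successors k false U) ≤ y
    hitter-bound y∈ with ∈-successors⁻ k′ false S y∈
    ... | u , _ , refl with T? (legal es U u)
    ...   | yes lu = ≤-trans (minList-≤ (∈-successors⁺ k false U lu)) (IH (≼-select-both u S≼U))
    ...   | no ¬lu = let w , lw = legal-exists U ne ¬tU in
                     ≤-trans (minList-≤ (∈-successors⁺ k false U lw)) (IH (≼-select-illegal w S≼U ¬lu))

    staller-bound : ∀ {y} → y ∈ successors k true U → y ≤ maxList (successors k′ true S)
    staller-bound y∈ with ∈-successors⁻ k true U y∈
    ... | v , lv , refl =
      ≤-trans (IH (≼-select-both v S≼U)) (≤-maxList (∈-successors⁺ k′ true S (≼-legal S≼U lv)))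

    by-turn : ∀ p → gameValue es (suc k) p U ≤ gameValue es (suc k′) p S
    by-turn true rewrite gameValue-hitter U k ¬tU | gameValue-hitter S k′ ¬tS =
      s≤s (≤-minList (∈-successors⁺ k′ false S (proj₂ (legal-exists S ne ¬tS))) hitter-bound)
    by-turn false rewrite gameValue-staller U k ¬tU | gameValue-staller S k′ ¬tS =
      s≤s (maxList-≤ staller-bound)

  -- Each legal move selects an unselected vertex, so with this fuel a move uses up exactly one unit.
  value : Bool → Subset n → ℕ
  value p S = gameValue es (unselected S) p S

  unselected-legal : ∀ S {v} → T (legal es S v) → unselected S ≡ suc (unselected (S [ v ]≔ true))
  unselected-legal S lv = unselected-select S _ (legal⇒unselected S lv)

  value-transversal : ∀ p S → T (isTransversal es S) → value p S ≡ 0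
  value-transversal p S = gameValue-transversal (unselected S) p S

  module _ (S : Subset n) {u} (lu : T (legal es S u)) where

    private
      k = unselected (S [ u ]≔ true)

      successor-value : ∀ p {v} → T (legal es S v) → gameValue es k p (S [ v ]≔ true) ≡ value p (S [ v ]≔ true)
      successor-value p lv = cong (λ k → gameValue es k p _)
        (suc-injective (trans (sym (unselected-legal S lu)) (unselected-legal S lv)))

      value-hitter : value true S ≡ suc (minList (successors k false S))
      value-hitter = trans (cong (λ k → gameValue es k true S) (unselected-legal S lu))
                           (gameValue-hitter S k (legal⇒¬isTransversal S lu))

      value-staller : value false S ≡ suc (maxList (successors k true S))
      value-staller = trans (cong (λ k → gameValue es k false S) (unselected-legal S lu))
                            (gameValue-staller S k (legal⇒¬isTransversal S lu))

    value-hitter-≤ : value true S ≤ suc (value false (S [ u ]≔ true))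
    value-hitter-≤ = ≤-trans (≤-reflexive value-hitter) (s≤s (minList-≤ (∈-successors⁺ k false S lu)))

    value-hitter-≥ : ∀ {b} → (∀ {v} → T (legal es S v) → b ≤ value false (S [ v ]≔ true)) →
                     suc b ≤ value true S
    value-hitter-≥ {b} b≤ =
      ≤-trans (s≤s (≤-minList (∈-successors⁺ k false S lu) bound)) (≤-reflexive (sym value-hitter))
      where
      bound : ∀ {y} → y ∈ successors k false S → b ≤ y
      bound y∈ with ∈-successors⁻ k false S y∈
      ... | v , lv , refl = subst (b ≤_) (sym (successor-value false lv)) (b≤ lv)

    value-staller-≥ : suc (value true (S [ u ]≔ true)) ≤ value false S
    value-staller-≥ = ≤-trans (s≤s (≤-maxList (∈-successors⁺ k true S lu))) (≤-reflexive (sym value-staller))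

    value-staller-optimal : ∃ λ v → T (legal es S v) × value false S ≡ suc (value true (S [ v ]≔ true))
    value-staller-optimal with ∈-successors⁻ k true S (maxList-∈ (∈-successors⁺ k true S lu))
    ... | v , lv , eq = v , lv , trans value-staller (cong suc (trans eq (successor-value true lv)))

  value-antitone : All Nonempty es → ∀ {p S U} → S ≼ U → unselected U ≤ unselected S → value p U ≤ value p S
  value-antitone ne S≼U u≤ = gameValue-mono ne u≤ S≼U

  -- An extra selected vertex never lengthens the game (value-antitone), so value true P ≤ 1 + value false P.
  staller-out-of-turn : All Nonempty es → ∀ P {w} → T (legal es P w) →
                        ∃ λ v → T (legal es P v) × value true P ≤ 2 + value true (P [ v ]≔ true)
  staller-out-of-turn ne P {w} lw = v , lv , (begin
      value true P                    ≤⟨ value-hitter-≤ P lw ⟩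
      suc (value false (P [ w ]≔ true)) ≤⟨ s≤s (value-antitone ne (≼-select P w) fewer) ⟩
      suc (value false P)             ≡⟨ cong suc eq ⟩
      2 + value true (P [ v ]≔ true)  ∎)
    where
    open ≤-Reasoning
    optimal = value-staller-optimal P lw
    v = proj₁ optimal
    lv = proj₁ (proj₂ optimal)
    eq = proj₂ (proj₂ optimal)
    fewer : unselected (P [ w ]≔ true) ≤ unselected P
    fewer = ≤-trans (n≤1+n _) (≤-reflexive (sym (unselected-legal P lw)))

module Copies {n : ℕ} (es : List (Subset n)) (m : ℕ) where

  es′ : List (Subset (m * n))
  es′ = edges (copies m (hypergraph n es))

  restrict : Fin m → Subset (m * n) → Subset n
  restrict j S = tabulate (λ b → lookup S (combine j b))

  restrict-select-same : ∀ S i u → restrict i (S [ combine i u ]≔ true) ≡ restrict i S [ u ]≔ true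
  restrict-select-same S i u = Pointwise-≡⇒≡ (ext pointwise)
    where
    pointwise : ∀ b → lookup (restrict i (S [ combine i u ]≔ true)) b ≡ lookup (restrict i S [ u ]≔ true) b
    pointwise b rewrite lookup∘tabulate (λ b → lookup (S [ combine i u ]≔ true) (combine i b)) b with b ≟ u
    ... | yes refl = trans (lookup∘update (combine i b) S true) (sym (lookup∘update b (restrict i S) true))
    ... | no b≢u = begin
      lookup (S [ combine i u ]≔ true) (combine i b) ≡⟨ lookup∘update′ (b≢u ∘ combine-injectiveʳ i b i u) S true ⟩
      lookup S (combine i b)                         ≡⟨ lookup∘tabulate _ b ⟨
      lookup (restrict i S) b                        ≡⟨ lookup∘update′ b≢u (restrict i S) true ⟨
      lookup (restrict i S [ u ]≔ true) b            ∎
      where open ≡-Reasoning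

  restrict-select-other : ∀ S {i l} u → l ≢ i → restrict l (S [ combine i u ]≔ true) ≡ restrict l S
  restrict-select-other S {i} {l} u l≢i =
    tabulate-cong (λ b → lookup∘update′ (l≢i ∘ combine-injectiveˡ l b i u) S true)

  restrict-replicate : ∀ j → restrict j (replicate (m * n) false) ≡ replicate n false
  restrict-replicate j = Pointwise-≡⇒≡ (ext λ b → begin
    lookup (restrict j (replicate (m * n) false)) b ≡⟨ lookup∘tabulate _ b ⟩
    lookup (replicate (m * n) false) (combine j b)  ≡⟨ lookup-replicate (combine j b) false ⟩
    false                                           ≡⟨ lookup-replicate b false ⟨
    lookup (replicate n false) b                    ∎)
    where open ≡-Reasoning

  lookup-liftEdge : ∀ i j (e : Subset n) b → lookup (liftEdge {m} j e) (combine i b) ≡ (⌊ i ≟ j ⌋ ∧ lookup e b)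
  lookup-liftEdge i j e b =
    trans (lookup∘tabulate _ (combine i b)) (cong (λ (a , c) → ⌊ a ≟ j ⌋ ∧ lookup e c) (remQuot-combine i b))

  liftEdge-combine : ∀ j (e : Subset n) b → lookup (liftEdge {m} j e) (combine j b) ≡ lookup e b
  liftEdge-combine j e b rewrite lookup-liftEdge j j e b with j ≟ j
  ... | yes _ = refl
  ... | no j≢j = contradiction refl j≢j

  liftEdge⁻ : ∀ j (e : Subset n) x → T (lookup (liftEdge {m} j e) x) → ∃ λ b → x ≡ combine j b × T (lookup e b)
  liftEdge⁻ j e x h with remQuot {m} n x in eq
  ... | a , b with trans (sym (combine-remQuot {m} n x)) (cong (uncurry combine) eq)
  ...   | refl with a ≟ j | subst T (lookup-liftEdge a j e b) h
  ...     | yes refl | eb = b , refl , eb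

  ∈-copies⁺ : ∀ {e} j → e ∈ es → liftEdge {m} j e ∈ es′
  ∈-copies⁺ j e∈ =
    ∈-concatMap⁺ (λ j → map (liftEdge {m} j) es) (lose (∈-allFin j) (∈-map⁺ (liftEdge {m} j) e∈))

  ∈-copies⁻ : ∀ {e′} → e′ ∈ es′ → ∃₂ λ j e → e ∈ es × e′ ≡ liftEdge {m} j e
  ∈-copies⁻ e′∈ =
    let j , e′∈j = Any.satisfied (∈-concatMap⁻ (λ j → map (liftEdge {m} j) es) {xs = allFin m} e′∈)
        e , e∈ , e′≡ = ∈-map⁻ (liftEdge {m} j) e′∈j
    in j , e , e∈ , e′≡

  meets-liftEdge⁺ : ∀ j e S → T (meets e (restrict j S)) → T (meets (liftEdge {m} j e) S)
  meets-liftEdge⁺ j e S h =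
    let b , eb , Sb = meets⁻ e (restrict j S) h
    in meets⁺ (liftEdge {m} j e) S (combine j b) (subst T (sym (liftEdge-combine j e b)) eb)
                                              (subst T (lookup∘tabulate _ b) Sb)

  meets-liftEdge⁻ : ∀ j e S → T (meets (liftEdge {m} j e) S) → T (meets e (restrict j S))
  meets-liftEdge⁻ j e S h with meets⁻ (liftEdge {m} j e) S h
  ... | x , ex , Sx with liftEdge⁻ j e x ex
  ...   | b , refl , eb = meets⁺ e (restrict j S) b eb (subst T (sym (lookup∘tabulate _ b)) Sx)

  module Copy = Game es
  module Union = Game es′

  legal-copies⁺ : ∀ S {i u} → T (legal es (restrict i S) u) → T (legal es′ S (combine i u))
  legal-copies⁺ S {i} {u} lu =
    let e , e∈ , eu , ¬m = Copy.legal⁻ (restrict i S) lu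
    in Union.legal⁺ S (∈-copies⁺ i e∈) (subst T (sym (liftEdge-combine i e u)) eu) (¬m ∘ meets-liftEdge⁻ i e S)

  legal-copies⁻ : ∀ S {x} → T (legal es′ S x) → ∃₂ λ i u → x ≡ combine i u × T (legal es (restrict i S) u)
  legal-copies⁻ S lx with Union.legal⁻ S lx
  ... | e′ , e′∈ , e′x , ¬m with ∈-copies⁻ e′∈
  ...   | i , e , e∈ , refl with liftEdge⁻ i e _ e′x
  ...     | u , refl , eu = i , u , refl , Copy.legal⁺ (restrict i S) e∈ eu (¬m ∘ meets-liftEdge⁺ i e S)

  isTransversal-copies⁻ : ∀ S j → T (isTransversal es′ S) → T (isTransversal es (restrict j S))
  isTransversal-copies⁻ S j t =
    Copy.isTransversal⁺ (restrict j S) λ {e} e∈ →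
      meets-liftEdge⁻ j e S (Union.isTransversal⁻ S t (∈-copies⁺ j e∈))

NoEmptyEdge-copies : ∀ m H → NoEmptyEdge H → NoEmptyEdge (copies m H)
NoEmptyEdge-copies m (hypergraph n es) ne = All.tabulate λ e′∈ →
  let j , e , e∈ , e′≡ = ∈-copies⁻ e′∈ ; b , b∈e = All.lookup ne e∈
  in subst Nonempty (sym e′≡)
       (combine j b , lookup⇒[]= (combine j b) _ (trans (liftEdge-combine j e b) ([]=⇒lookup b∈e)))
  where open Copies es m

module Potential {n : ℕ} (es : List (Subset n)) (ne : All Nonempty es) (m : ℕ) where

  open Copies es m

  ne′ : All Nonempty es′
  ne′ = NoEmptyEdge-copies m (hypergraph n es) ne

  copyPotential : Subset n → ℕ
  copyPotential P = Copy.value true P ∸ 1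

  potential : Subset (m * n) → ℕ
  potential S = sum (λ j → copyPotential (restrict j S))

  copyPotential-≤ : ∀ P P′ → Copy.value true P ≤ 2 + Copy.value true P′ →
                    copyPotential P ≤ 2 + copyPotential P′
  copyPotential-≤ P P′ h = ≤-trans (∸-monoˡ-≤ 1 h) (s≤s (m≤n+m∸n (Copy.value true P′) 1))

  potential-transversal : ∀ S → T (isTransversal es′ S) → potential S ≡ 0
  potential-transversal S t = trans
    (sum-cong-≗ λ j → cong (_∸ 1) (Copy.value-transversal true (restrict j S) (isTransversal-copies⁻ S j t)))
    (trans (sum-const m 0) (*-zeroʳ m))

  potential-≤-except : ∀ S S″ j → (∀ l → l ≢ j → restrict l S ≡ restrict l S″) →
                       copyPotential (restrict j S) ≤ 2 + copyPotential (restrict j S″) →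
                       potential S ≤ 2 + potential S″
  potential-≤-except S S″ j same = sum-≤-except j 2 (λ l l≢j → ≤-reflexive (cong copyPotential (same l l≢j)))

  reply-in-copy : ∀ S i u → T (legal es (restrict i S) u) → ¬ T (isTransversal es (restrict i S [ u ]≔ true)) →
                  let S′ = S [ combine i u ]≔ true in
                  ∃ λ y → T (legal es′ S′ y) × potential S ≤ 2 + potential (S′ [ y ]≔ true)
  reply-in-copy S i u lu ¬t = combine i v , legal-copies⁺ S′ lv′ , potential-≤-except S S″ i same bound
    where
    P = restrict i S
    S′ = S [ combine i u ]≔ true
    optimal = Copy.value-staller-optimal (P [ u ]≔ true) (proj₂ (Copy.legal-exists (P [ u ]≔ true) ne ¬t))
    v = proj₁ optimal
    S″ = S′ [ combine i v ]≔ true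
    restrict-S′ : restrict i S′ ≡ P [ u ]≔ true
    restrict-S′ = restrict-select-same S i u
    lv′ : T (legal es (restrict i S′) v)
    lv′ = subst (λ Q → T (legal es Q v)) (sym restrict-S′) (proj₁ (proj₂ optimal))
    same : ∀ l → l ≢ i → restrict l S ≡ restrict l S″
    same l l≢i = sym (trans (restrict-select-other S′ v l≢i) (restrict-select-other S u l≢i))
    bound : copyPotential P ≤ 2 + copyPotential (restrict i S″)
    bound rewrite restrict-select-same S′ i v | restrict-S′ = copyPotential-≤ P ((P [ u ]≔ true) [ v ]≔ true)
      (≤-trans (Copy.value-hitter-≤ P lu) (≤-reflexive (cong suc (proj₂ (proj₂ optimal)))))

  open-copy : ∀ S → ¬ T (isTransversal es′ S) → ∃₂ λ j w → T (legal es (restrict j S) w)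
  open-copy S ¬t = let j , w , _ , lw = legal-copies⁻ S (proj₂ (Union.legal-exists S ne′ ¬t)) in j , w , lw

  reply-out-of-turn : ∀ S j w → T (legal es (restrict j S) w) →
                      ∃ λ y → T (legal es′ S y) × potential S ≤ 2 + potential (S [ y ]≔ true)
  reply-out-of-turn S j w lw = combine j v , legal-copies⁺ S lv , potential-≤-except S S′ j same bound
    where
    reply = Copy.staller-out-of-turn ne (restrict j S) lw
    v = proj₁ reply
    lv = proj₁ (proj₂ reply)
    S′ = S [ combine j v ]≔ true
    same : ∀ l → l ≢ j → restrict l S ≡ restrict l S′
    same l l≢j = sym (restrict-select-other S v l≢j)
    bound : copyPotential (restrict j S) ≤ 2 + copyPotential (restrict j S′)
    bound rewrite restrict-select-same S j v =
      copyPotential-≤ (restrict j S) (restrict j S [ v ]≔ true) (proj₂ (proj₂ reply))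

  potential-≤-after-finishing-move : ∀ S i u → T (legal es (restrict i S) u) →
                                     T (isTransversal es (restrict i S [ u ]≔ true)) →
                                     potential S ≤ potential (S [ combine i u ]≔ true)
  potential-≤-after-finishing-move S i u lu t = sum-mono pointwise
    where
    pointwise : ∀ l → copyPotential (restrict l S) ≤ copyPotential (restrict l (S [ combine i u ]≔ true))
    pointwise l with l ≟ i
    ... | no l≢i = ≤-reflexive (cong copyPotential (sym (restrict-select-other S u l≢i)))
    ... | yes refl =
      ≤-trans (∸-monoˡ-≤ 1 (≤-trans (Copy.value-hitter-≤ (restrict i S) lu) (≤-reflexive finished))) z≤n
      where
      finished : suc (Copy.value false (restrict i S [ u ]≔ true)) ≡ 1
      finished = cong suc (Copy.value-transversal false (restrict i S [ u ]≔ true) t)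

  staller-reply : ∀ S {x} → T (legal es′ S x) →
                  let S′ = S [ x ]≔ true in
                  potential S ≡ 0 ⊎ ∃ λ y → T (legal es′ S′ y) × potential S ≤ 2 + potential (S′ [ y ]≔ true)
  staller-reply S lx with legal-copies⁻ S lx
  ... | i , u , refl , lu with T? (isTransversal es (restrict i S [ u ]≔ true))
  ...   | no ¬t = inj₂ (reply-in-copy S i u lu ¬t)
  ...   | yes t with T? (isTransversal es′ (S [ combine i u ]≔ true))
  ...     | yes t′ = inj₁ (n≤0⇒n≡0 (≤-trans (potential-≤-after-finishing-move S i u lu t)
                                             (≤-reflexive (potential-transversal (S [ combine i u ]≔ true) t′))))
  ...     | no ¬t′ = let j , w , lw = open-copy (S [ combine i u ]≔ true) ¬t′ in
                     inj₂ (Product.map₂ (Product.map₂ (≤-trans (potential-≤-after-finishing-move S i u lu t)))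
                                        (reply-out-of-turn (S [ combine i u ]≔ true) j w lw))

  potential-≤-value : ∀ K S → unselected S < K → potential S ≤ Union.value true S
  potential-≤-value (suc K) S u<K with T? (isTransversal es′ S)
  ... | yes t = ≤-reflexive (trans (potential-transversal S t) (sym (Union.value-transversal true S t)))
  ... | no ¬t =
    ≤-trans (m≤n+m∸n (potential S) 1) (Union.value-hitter-≥ S (proj₂ (Union.legal-exists S ne′ ¬t)) after-hitter)
    where
    after-hitter : ∀ {x} → T (legal es′ S x) → potential S ∸ 1 ≤ Union.value false (S [ x ]≔ true)
    after-hitter {x} lx with staller-reply S lx
    ... | inj₁ no-potential = ≤-trans (≤-reflexive (cong (_∸ 1) no-potential)) z≤n
    ... | inj₂ (y , ly , bound) = begin
      potential S ∸ 1           ≤⟨ ∸-monoˡ-≤ 1 bound ⟩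
      suc (potential S″)        ≤⟨ s≤s (potential-≤-value K S″ fewer) ⟩
      suc (Union.value true S″) ≤⟨ Union.value-staller-≥ S′ ly ⟩
      Union.value false S′      ∎
      where
      open ≤-Reasoning
      S′ = S [ x ]≔ true
      S″ = S′ [ y ]≔ true
      fewer : unselected S″ < K
      fewer = ≤-trans (n≤1+n _)
        (subst (_≤ K) (trans (Union.unselected-legal S lx) (cong suc (Union.unselected-legal S′ ly))) (s≤s⁻¹ u<K))

τg-copies-≥ : ∀ m H → NoEmptyEdge H → m * (τg H ∸ 1) ≤ τg (copies m H)
τg-copies-≥ m H@(hypergraph n es) ne = begin
  m * (τg H ∸ 1)           ≡⟨ sum-const m (τg H ∸ 1) ⟨
  sum {m} (λ _ → τg H ∸ 1) ≡⟨ sum-cong-≗ (λ j → trans empty-copy (cong copyPotential (sym (restrict-replicate j)))) ⟩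
  potential ∅              ≤⟨ potential-≤-value (suc (m * n)) ∅ (s≤s (≤-reflexive (unselected-replicate (m * n)))) ⟩
  Union.value true ∅       ≡⟨ cong (λ k → gameValue es′ k true ∅) (unselected-replicate (m * n)) ⟩
  τg (copies m H)          ∎
  where
  open ≤-Reasoning
  open Copies es m
  open Potential es ne m
  ∅ = replicate (m * n) false
  empty-copy : τg H ∸ 1 ≡ copyPotential (replicate n false)
  empty-copy = cong (λ k → gameValue es k true (replicate n false) ∸ 1) (sym (unselected-replicate n))

toℚ : ℕ → ℚ
toℚ k = + k ℚ./ 1

toℚ-normal : ∀ k → toℚ k ≡ mkℚ (+ k) 0 (coprime-sym (1-coprimeTo k))
toℚ-normal k = ℚP.normalize-coprime (coprime-sym (1-coprimeTo k))

toℚ-mono-≤ : ∀ {a b} → a ≤ b → toℚ a ℚ.≤ toℚ b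
toℚ-mono-≤ {a} {b} a≤b rewrite toℚ-normal a | toℚ-normal b =
  *≤* (subst₂ ℤ._≤_ (sym (ℤP.*-identityʳ (+ a))) (sym (ℤP.*-identityʳ (+ b))) (ℤ.+≤+ a≤b))

toℚ-+ : ∀ a b → toℚ (a + b) ≡ toℚ a ℚ.+ toℚ b
toℚ-+ a b rewrite toℚ-normal a | toℚ-normal b =
  cong (ℚ._/ 1) (trans (ℤP.pos-+ a b) (sym (cong₂ ℤ._+_ (ℤP.*-identityʳ (+ a)) (ℤP.*-identityʳ (+ b)))))

toℚ-* : ∀ a b → toℚ (a * b) ≡ toℚ a ℚ.* toℚ b
toℚ-* a b rewrite toℚ-normal a | toℚ-normal b = cong (ℚ._/ 1) (ℤP.pos-* a b)

toℚ-pos : ∀ k → ℚ.Positive (toℚ (suc k))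
toℚ-pos k = subst ℚ.Positive (sym (toℚ-normal (suc k))) _

toℚ-*-cancelˡ-≤ : ∀ k {a n} x → toℚ (suc k * a) ℚ.≤ x ℚ.* toℚ (suc k * n) → toℚ a ℚ.≤ x ℚ.* toℚ n
toℚ-*-cancelˡ-≤ k {a} {n} x h = ℚP.*-cancelˡ-≤-pos (toℚ (suc k)) {{toℚ-pos k}} (subst₂ ℚ._≤_ lhs rhs h)
  where
  lhs : toℚ (suc k * a) ≡ toℚ (suc k) ℚ.* toℚ a
  lhs = toℚ-* (suc k) a
  rhs : x ℚ.* toℚ (suc k * n) ≡ toℚ (suc k) ℚ.* (x ℚ.* toℚ n)
  rhs = trans (cong (x ℚ.*_) (toℚ-* (suc k) n)) (x∙yz≈y∙xz x (toℚ (suc k)) (toℚ n))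

p≤∣p∣ : ∀ p → p ℚ.≤ ∣ p ∣
p≤∣p∣ (mkℚ (+ _) _ _) = ℚP.≤-refl
p≤∣p∣ (mkℚ -[1+ _ ] _ _) = *≤* ℤ.-≤+

Vanishing : (ℕ → ℚ) → Set
Vanishing f = ∀ ε → 0ℚ ℚ.< ε → ∃[ N ] (∀ n → N ≤ n → ∣ f n ∣ ℚ.< ε)

Vanishing-∘ : ∀ {f} h → (∀ k → k ≤ h k) → Vanishing f → Vanishing (f ∘ h)
Vanishing-∘ h k≤h f→0 ε ε>0 =
  let N , small = f→0 ε ε>0 in N , λ k N≤k → small (h k) (≤-trans N≤k (k≤h k))

≤-if-<-+-pos : ∀ a b → (∀ ε → 0ℚ ℚ.< ε → a ℚ.< b ℚ.+ ε) → a ℚ.≤ b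
≤-if-<-+-pos a b a<b+ε with a ℚP.≤? b
... | yes a≤b = a≤b
... | no a≰b = contradiction (subst (a ℚ.<_) b+[a-b]≡a (a<b+ε (a ℚ.- b) a-b>0)) (ℚP.<-irrefl refl)
  where
  b+[a-b]≡a : b ℚ.+ (a ℚ.- b) ≡ a
  b+[a-b]≡a = trans (sym (ℚP.+-assoc b a (ℚ.- b))) (xyx⁻¹≈y b a)
  a-b>0 : 0ℚ ℚ.< a ℚ.- b
  a-b>0 = subst (ℚ._< a ℚ.- b) (ℚP.+-inverseʳ b) (ℚP.+-monoˡ-< (ℚ.- b) (ℚP.≰⇒> a≰b))

≤-if-vanishing-excess : ∀ {a y} c g → 0ℚ ℚ.< y → Vanishing g → (∀ k → a ℚ.≤ (c ℚ.+ g k) ℚ.* y) →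
                        a ℚ.≤ c ℚ.* y
≤-if-vanishing-excess {a} {y} c g y>0 g→0 a≤ = ≤-if-<-+-pos a (c ℚ.* y) below
  where
  instance
    y-pos = ℚ.positive y>0
    y-nonNeg = ℚP.pos⇒nonNeg y
    y-nonZero = ℚP.pos⇒nonZero y

  below : ∀ ε → 0ℚ ℚ.< ε → a ℚ.< c ℚ.* y ℚ.+ ε
  below ε ε>0 = begin-strict
    a                          ≤⟨ a≤ N ⟩
    (c ℚ.+ g N) ℚ.* y          ≡⟨ ℚP.*-distribʳ-+ y c (g N) ⟩
    c ℚ.* y ℚ.+ g N ℚ.* y      ≤⟨ ℚP.+-monoʳ-≤ (c ℚ.* y) (ℚP.*-monoʳ-≤-nonNeg y (p≤∣p∣ (g N))) ⟩
    c ℚ.* y ℚ.+ ∣ g N ∣ ℚ.* y  <⟨ ℚP.+-monoʳ-< (c ℚ.* y) (ℚP.*-monoˡ-<-pos y (small N ≤-refl)) ⟩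
    c ℚ.* y ℚ.+ ε′ ℚ.* y       ≡⟨ cong (c ℚ.* y ℚ.+_) ε′*y≡ε ⟩
    c ℚ.* y ℚ.+ ε              ∎
    where
    open ℚP.≤-Reasoning
    instance
      ε-pos = ℚ.positive ε>0
    ε′ = ε ℚ.* ℚ.1/ y
    ε′>0 : 0ℚ ℚ.< ε′
    ε′>0 = ℚP.positive⁻¹ ε′ {{ℚP.pos*pos⇒pos ε (ℚ.1/ y) {{ℚP.1/pos⇒pos y}}}}
    N = proj₁ (g→0 ε′ ε′>0)
    small = proj₂ (g→0 ε′ ε′>0)
    ε′*y≡ε : ε′ ℚ.* y ≡ ε
    ε′*y≡ε = trans (ℚP.*-assoc ε (ℚ.1/ y) y) (trans (cong (ε ℚ.*_) (ℚP.*-inverseˡ y)) (ℚP.*-identityʳ ε))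

lemma5p1 : (C : Hypergraph → Set)
    → (∀ H → C H → NoEmptyEdge H)
    → (∀ H m → C H → 1 ≤ m → C (copies m H))
    → (c : ℚ) → 0ℚ ℚ.< c
    → (f : ℕ → ℚ)
    → (∀ ε → 0ℚ ℚ.< ε → ∃[ N ] (∀ n → N ≤ n → ∣ f n ∣ ℚ.< ε))
    → (∀ H → C H → (+ τg H) ℚ./ 1 ℚ.≤ (c ℚ.+ f (order H)) ℚ.* ((+ order H) ℚ./ 1))
    → ∀ H → C H → (+ τg H) ℚ./ 1 ℚ.≤ c ℚ.* ((+ order H) ℚ./ 1) ℚ.+ 1ℚ
lemma5p1 C noEmpty closed c _ f f→0 bound (hypergraph zero es) _ =
  subst (λ z → 0ℚ ℚ.≤ z ℚ.+ 1ℚ) (sym (ℚP.*-zeroʳ c)) (*≤* (ℤ.+≤+ z≤n))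
lemma5p1 C noEmpty closed c _ f f→0 bound H@(hypergraph (suc n′) es) CH = begin
  toℚ τ                   ≤⟨ toℚ-mono-≤ (m≤n+m∸n τ 1) ⟩
  toℚ (1 + (τ ∸ 1))       ≡⟨ trans (toℚ-+ 1 (τ ∸ 1)) (ℚP.+-comm 1ℚ (toℚ (τ ∸ 1))) ⟩
  toℚ (τ ∸ 1) ℚ.+ 1ℚ      ≤⟨ ℚP.+-monoˡ-≤ 1ℚ τ∸1≤cn ⟩
  c ℚ.* toℚ n ℚ.+ 1ℚ      ∎
  where
  open ℚP.≤-Reasoning
  n = suc n′
  τ = τg H
  per-copy : ∀ k → toℚ (τ ∸ 1) ℚ.≤ (c ℚ.+ f (suc k * n)) ℚ.* toℚ n
  per-copy k = toℚ-*-cancelˡ-≤ k {τ ∸ 1} {n} (c ℚ.+ f (suc k * n)) (ℚP.≤-trans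
    (toℚ-mono-≤ (τg-copies-≥ (suc k) H (noEmpty H CH)))
    (bound (copies (suc k) H) (closed H (suc k) CH (s≤s z≤n))))
  τ∸1≤cn : toℚ (τ ∸ 1) ℚ.≤ c ℚ.* toℚ n
  τ∸1≤cn = ≤-if-vanishing-excess c (λ k → f (suc k * n)) (ℚP.positive⁻¹ (toℚ n) {{toℚ-pos n′}})
    (Vanishing-∘ (λ k → suc k * n) (λ k → ≤-trans (n≤1+n k) (m≤m*n (suc k) n)) f→0) per-copy
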